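{- For every positive integer $k$, there exist a finite simple undirected graph $G$ and an orientation $\vec{G}$ of $G$ such that $$\operatorname{adim}(G) \geq \operatorname{bdim}(G) = 2^k + k - 1 \quad\text{and}\quad k \geq \operatorname{adim}(\vec{G}) \geq \operatorname{bdim}(\vec{G}).$$
   Context: An orientation $\vec{G}$ of $G$ is the directed graph obtained by assigning a direction to each edge of $G$. For a graph (undirected, or directed), $d(u,v)$ is the length of a shortest path (respectively, shortest directed path) from $u$ to $v$, or $\infty$ if none exists; for a positive integer $k$, $d_k(u,v) := \min(d(u,v),k+1)$. A function $f : V \to \mathbb{Z}_{\geq 0}$ is a resolving broadcast if for any distinct vertices $x,y$ there is $z$ with $f(z)>0$ and $d_{f(z)}(z,x)\neq d_{f(z)}(z,y)$. The broadcast dimension $\operatorname{bdim}$ is the minimum of $\sum_v f(v)$ over all resolving broadcasts $f$. An adjacency resolving set is a set $A$ of vertices such that for any distinct $x,y$ there is $z\in A$ with $d_1(z,x)\neq d_1(z,y)$; the adjacency dimension $\operatorname{adim}$ is the minimum cardinality of such a set. -}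

module Defs where

open import Data.Nat using (ℕ; zero; suc; _+_; _≤_; _<_)
open import Data.Bool using (Bool; true; false)
open import Data.Fin using (Fin)
open import Data.Fin.Subset using (Subset; _∈_; ∣_∣)
open import Data.List using (List; map; allFin)
open import Data.Nat.ListAction using (sum)
open import Data.Product using (Σ; _×_; ∃)
open import Data.Sum using (_⊎_)
open import Relation.Nullary using (¬_)
open import Relation.Binary.PropositionalEquality using (_≡_; _≢_)

-- A (di)graph on vertex set Fin n is given by a Boolean arc relation:
-- E u v ≡ true means there is an edge/arc from u to v.
Rel : ℕ → Set
Rel n = Fin n → Fin n → Bool

IsSimpleGraph : ∀ {n} → Rel n → Set
IsSimpleGraph {n} adj =
  (∀ (u v : Fin n) → adj u v ≡ adj v u) × (∀ (u : Fin n) → adj u u ≡ false)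

IsOrientation : ∀ {n} → Rel n → Rel n → Set
IsOrientation {n} adj arc =
  (∀ (u v : Fin n) → arc u v ≡ true → adj u v ≡ true) ×
  (∀ (u v : Fin n) → adj u v ≡ true →
     (arc u v ≡ true × arc v u ≡ false) ⊎ (arc u v ≡ false × arc v u ≡ true))

data Walk {n} (E : Rel n) : Fin n → Fin n → ℕ → Set where
  here : ∀ {u} → Walk E u u 0
  step : ∀ {u w v ℓ} → E u w ≡ true → Walk E w v ℓ → Walk E u v (suc ℓ)

-- d(u,v) = m  (finite): a walk of length m exists and none shorter.
-- (The shortest walk length equals the shortest path length.)
DistIs : ∀ {n} → Rel n → Fin n → Fin n → ℕ → Set
DistIs E u v m = Walk E u v m × (∀ ℓ → ℓ < m → ¬ Walk E u v ℓ)

-- d_k(u,v) = m, where d_k(u,v) = min(d(u,v), k+1)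
DkIs : ∀ {n} → Rel n → ℕ → Fin n → Fin n → ℕ → Set
DkIs E k u v m =
  (m ≤ k × DistIs E u v m) ⊎
  (m ≡ suc k × (∀ ℓ → ℓ ≤ k → ¬ Walk E u v ℓ))

total : ∀ {n} → (Fin n → ℕ) → ℕ
total {n} f = sum (map f (allFin n))

Separates : ∀ {n} → Rel n → ℕ → Fin n → Fin n → Fin n → Set
Separates E k z x y =
  Σ ℕ λ m → Σ ℕ λ m' → DkIs E k z x m × DkIs E k z y m' × m ≢ m'

IsResolvingBroadcast : ∀ {n} → Rel n → (Fin n → ℕ) → Set
IsResolvingBroadcast {n} E f =
  ∀ (x y : Fin n) → x ≢ y →
    Σ (Fin n) λ z → (0 < f z) × Separates E (f z) z x y

BdimIs : ∀ {n} → Rel n → ℕ → Set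
BdimIs {n} E b =
  (Σ (Fin n → ℕ) λ f → IsResolvingBroadcast E f × total f ≡ b) ×
  (∀ (f : Fin n → ℕ) → IsResolvingBroadcast E f → b ≤ total f)

IsAdjacencyResolving : ∀ {n} → Rel n → Subset n → Set
IsAdjacencyResolving {n} E A =
  ∀ (x y : Fin n) → x ≢ y → Σ (Fin n) λ z → z ∈ A × Separates E 1 z x y

AdimIs : ∀ {n} → Rel n → ℕ → Set
AdimIs {n} E a =
  (Σ (Subset n) λ A → IsAdjacencyResolving E A × ∣ A ∣ ≡ a) ×
  (∀ (A : Subset n) → IsAdjacencyResolving E A → a ≤ ∣ A ∣)

{-# OPTIONS --safe #-}
-- G is the complete graph on n = k + 2^k vertices: two vertices of range 0 could only be
-- separated by a third vertex, which is adjacent to both, so adim = bdim = n − 1.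
-- The orientation is a tournament on Fin k ⊎ Vec Bool k in which i → p iff bit i of p is set,
-- so the k vertices of Fin k adjacency-resolve it. Its arcs are chosen so that each i has an
-- in-twin, the vector below i, with i ↛ below i; no third vertex can separate such twins at any
-- range, so every resolving broadcast spends at least 1 on each of the k twin pairs.
module Submission where

open import Defs
open import Data.Bool using (Bool; true; false; not; if_then_else_)
open import Data.Bool.Properties using (not-involutive) renaming (_≟_ to _≟ᵇ_)
open import Data.Empty using (⊥-elim)
open import Data.Fin using (Fin; zero; suc; punchIn; punchOut; _↑ˡ_) renaming (_≟_ to _≟ᶠ_)
open import Data.Fin.Properties
  using (any?; ¬∀⟶∃¬; punchIn-punchOut; punchIn-injective; punchInᵢ≢i; punchOut-injective; suc-injective; 2↔Bool; *↔×; +↔⊎)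
open import Data.Fin.Subset using (Subset; _∈_; ∣_∣; ⊤; ⊥; inside; outside)
open import Data.Fin.Subset.Properties using (∈⊤; ∣⊤∣≡n; ∣⊥∣≡0)
open import Data.List using (allFin)
open import Data.List.Properties using (map-tabulate; map-cong)
open import Data.Maybe using (Maybe; just; nothing)
open import Data.Nat using (ℕ; zero; suc; _+_; _∸_; _^_; _≤_; _<_; _≥_; z≤n; s≤s)
open import Data.Nat.ListAction using (sum)
open import Data.Nat.Properties
  using (≤-refl; ≤-trans; ≤-antisym; ≮⇒≥; n≤1+n; +-mono-≤; +-comm; +-suc; n≢0⇒n>0;
         +-commutativeSemigroup; module ≤-Reasoning)
  renaming (_≟_ to _≟ⁿ_)
open import Algebra.Properties.CommutativeSemigroup +-commutativeSemigroup using (x∙yz≈y∙xz)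
open import Data.Product using (Σ; _×_; _,_; ∃; proj₁; proj₂)
open import Data.Product.Function.NonDependent.Propositional using (_×-↔_)
open import Data.Sum using (_⊎_; inj₁; inj₂; [_,_]′)
open import Data.Sum.Properties using (inj₂-injective)
open import Data.Sum.Function.Propositional using (_⊎-↔_)
open import Data.Vec using (Vec; []; _∷_; lookup; replicate; here; there)
open import Data.Vec.Properties using (lookup-replicate; ≡-dec; tabulate∘lookup; tabulate-cong; []=⇒lookup; ∷-injectiveʳ)
open import Function using (_∘_; id)
open import Function.Bundles using (Inverse; _↔_; mk↔ₛ′)
open import Function.Definitions using (Injective)
open import Function.Properties.Inverse using (↔-refl; ↔-sym; ↔-trans)
open import Relation.Nullary using (¬_; yes; no; does)
open import Relation.Binary.PropositionalEquality
  using (_≡_; _≢_; refl; sym; trans; cong; subst; module ≡-Reasoning)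

-- Truncated distances and separation

InTwins : {A : Set} → (A → A → Bool) → A → A → Set
InTwins E x y = ∀ w → w ≢ x → w ≢ y → E w x ≡ E w y

module _ {n : ℕ} {E : Rel n} where

  walk-zero : ∀ {u v} → Walk E u v 0 → u ≡ v
  walk-zero here = refl

  _▷_ : ∀ {u w v ℓ} → Walk E u w ℓ → E w v ≡ true → Walk E u v (suc ℓ)
  here       ▷ e = step e here
  step e′ ws ▷ e = step e′ (ws ▷ e)

  lastStep : ∀ {u v ℓ} → Walk E u v (suc ℓ) → ∃ λ w → Walk E u w ℓ × E w v ≡ true
  lastStep (step e here)          = _ , here , e
  lastStep (step e ws@(step _ _)) with lastStep ws
  ... | w , ws′ , e′ = w , step e ws′ , e′

  DkIs-≤ : ∀ {k z x m} → DkIs E k z x m → m ≤ suc k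
  DkIs-≤ (inj₁ (m≤k , _)) = ≤-trans m≤k (n≤1+n _)
  DkIs-≤ (inj₂ (refl , _)) = ≤-refl

  DkIs-self : ∀ {k z} → DkIs E k z z 0
  DkIs-self = inj₁ (z≤n , here , λ _ ())

  NoFarther : Fin n → Fin n → Fin n → Set
  NoFarther z y x = ∀ {ℓ} → Walk E z x ℓ → ∃ λ ℓ′ → ℓ′ ≤ ℓ × Walk E z y ℓ′

  noFarther⇒DkIs-≤ : ∀ {k z x y m m′} → NoFarther z y x →
                     DkIs E k z x m → DkIs E k z y m′ → m′ ≤ m
  noFarther⇒DkIs-≤ _ (inj₂ (refl , _)) dy = DkIs-≤ dy
  noFarther⇒DkIs-≤ nf (inj₁ (m≤k , wx , _)) dy with nf wx
  ... | ℓ′ , ℓ′≤m , wy with dy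
  ...   | inj₁ (_ , _ , shortest) = ≤-trans (≮⇒≥ λ ℓ′<m′ → shortest ℓ′ ℓ′<m′ wy) ℓ′≤m
  ...   | inj₂ (_ , none)         = ⊥-elim (none ℓ′ (≤-trans ℓ′≤m m≤k) wy)

  equidistant⇒¬separates : ∀ {k z x y} → NoFarther z x y → NoFarther z y x →
                           ¬ Separates E k z x y
  equidistant⇒¬separates x≼y y≼x (_ , _ , dx , dy , m≢m′) =
    m≢m′ (≤-antisym (noFarther⇒DkIs-≤ x≼y dy dx) (noFarther⇒DkIs-≤ y≼x dx dy))

  separates-sym : ∀ {k z x y} → Separates E k z x y → Separates E k z y x
  separates-sym (m , m′ , dx , dy , m≢m′) = m′ , m , dy , dx , m≢m′ ∘ sym

  adjacentToBoth⇒¬separates : ∀ {k z x y} → z ≢ x → z ≢ y →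
                              E z x ≡ true → E z y ≡ true → ¬ Separates E k z x y
  adjacentToBoth⇒¬separates {z = z} z≢x z≢y zx zy = equidistant⇒¬separates (oneStep z≢y zx) (oneStep z≢x zy)
    where
    oneStep : ∀ {a b} → z ≢ b → E z a ≡ true → NoFarther z a b
    oneStep z≢b _  {zero}  w = ⊥-elim (z≢b (walk-zero w))
    oneStep _   za {suc ℓ} _ = 1 , s≤s z≤n , step za here

  arc≢noArc : ∀ {v u x} → E v x ≡ true → E u x ≡ false → v ≢ u
  arc≢noArc vx ux refl with trans (sym vx) ux
  ... | ()

  -- A walk to x enters it from some v; if v = y the walk already reached y, otherwise
  -- v → y as well. Symmetrically, a walk to y cannot enter it from x.
  inTwins⇒¬separates : (∀ u → E u u ≡ false) → ∀ {k z x y} →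
                       E x y ≡ false → InTwins E x y → z ≢ x → z ≢ y → ¬ Separates E k z x y
  inTwins⇒¬separates irr {z = z} {x} {y} x↛y twins z≢x z≢y = equidistant⇒¬separates x≼y y≼x
    where
    y≼x : NoFarther z y x
    y≼x {zero}  w = ⊥-elim (z≢x (walk-zero w))
    y≼x {suc ℓ} w with lastStep w
    ... | v , w′ , vx with v ≟ᶠ y
    ...   | yes refl = ℓ , n≤1+n ℓ , w′
    ...   | no v≢y   = suc ℓ , ≤-refl , w′ ▷ trans (sym (twins v (arc≢noArc vx (irr x)) v≢y)) vx
    x≼y : NoFarther z x y
    x≼y {zero}  w = ⊥-elim (z≢y (walk-zero w))
    x≼y {suc ℓ} w with lastStep w
    ... | v , w′ , vy = suc ℓ , ≤-refl , w′ ▷ trans (twins v (arc≢noArc vy x↛y) (arc≢noArc vy (irr y))) vy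

  adjacencyDistance : Bool → ℕ
  adjacencyDistance true  = 1
  adjacencyDistance false = 2

  adjacencyDistance-injective : ∀ {a b} → adjacencyDistance a ≡ adjacencyDistance b → a ≡ b
  adjacencyDistance-injective {true}  {true}  _ = refl
  adjacencyDistance-injective {false} {false} _ = refl

  0≢adjacencyDistance : ∀ b → 0 ≢ adjacencyDistance b
  0≢adjacencyDistance true  ()
  0≢adjacencyDistance false ()

  DkIs₁ : ∀ {z x} → z ≢ x → DkIs E 1 z x (adjacencyDistance (E z x))
  DkIs₁ {z} {x} z≢x with E z x in zx
  ... | true  = inj₁ (≤-refl , step zx here , λ { zero _ w → z≢x (walk-zero w) ; (suc _) (s≤s ()) })
  ... | false = inj₂ (refl , λ { zero _ w → z≢x (walk-zero w)
                               ; (suc zero) _ (step zx′ here) → noArc (trans (sym zx) zx′)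
                               ; (suc (suc _)) (s≤s ()) })
    where
    noArc : false ≢ true
    noArc ()

  separates₁-self : ∀ {x y} → x ≢ y → Separates E 1 x x y
  separates₁-self {x} {y} x≢y =
    0 , _ , DkIs-self , DkIs₁ x≢y , 0≢adjacencyDistance (E x y)

  separates₁-byArc : ∀ {z x y} → z ≢ x → z ≢ y → E z x ≢ E z y → Separates E 1 z x y
  separates₁-byArc z≢x z≢y arcs≢ =
    _ , _ , DkIs₁ z≢x , DkIs₁ z≢y , arcs≢ ∘ adjacencyDistance-injective

-- Sums over the vertices

total-suc : ∀ {n} (f : Fin (suc n) → ℕ) → total f ≡ f zero + total (f ∘ suc)
total-suc f = cong (λ xs → f zero + sum xs) (trans (map-tabulate suc f) (sym (map-tabulate id (f ∘ suc))))

total-cong : ∀ {n} {f g : Fin n → ℕ} → (∀ i → f i ≡ g i) → total f ≡ total g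
total-cong f≗g = cong sum (map-cong f≗g (allFin _))

total-punchIn : ∀ {n} (f : Fin (suc n) → ℕ) i → total f ≡ f i + total (f ∘ punchIn i)
total-punchIn f zero = total-suc f
total-punchIn {suc n} f (suc i) = begin
  total f                                         ≡⟨ total-suc f ⟩
  f zero + total (f ∘ suc)                        ≡⟨ cong (f zero +_) (total-punchIn (f ∘ suc) i) ⟩
  f zero + (f (suc i) + total (f ∘ suc ∘ punchIn i)) ≡⟨ x∙yz≈y∙xz (f zero) (f (suc i)) _ ⟩
  f (suc i) + (f zero + total (f ∘ suc ∘ punchIn i)) ≡⟨ cong (f (suc i) +_) (sym (total-suc {n} (f ∘ punchIn (suc i)))) ⟩
  f (suc i) + total (f ∘ punchIn (suc i))         ∎
  where open ≡-Reasoning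

total-∘-injective : ∀ {m n} (f : Fin n → ℕ) {g : Fin m → Fin n} →
                    Injective _≡_ _≡_ g → total (f ∘ g) ≤ total f
total-∘-injective {zero}               _ _ = z≤n
total-∘-injective {suc m} {zero}  _ {g} _ with g zero
... | ()
total-∘-injective {suc m} {suc n} f {g} g-inj = begin
  total (f ∘ g)                                  ≡⟨ total-suc (f ∘ g) ⟩
  f (g zero) + total (f ∘ g ∘ suc)               ≡⟨ cong (f (g zero) +_) (total-cong (cong f ∘ sym ∘ punchIn-punchOut ∘ g₀≢)) ⟩
  f (g zero) + total (f ∘ punchIn (g zero) ∘ g′) ≤⟨ +-mono-≤ ≤-refl (total-∘-injective (f ∘ punchIn (g zero)) g′-inj) ⟩
  f (g zero) + total (f ∘ punchIn (g zero))      ≡⟨ total-punchIn f (g zero) ⟨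
  total f                                        ∎
  where
  open ≤-Reasoning
  g₀≢ : ∀ i → g zero ≢ g (suc i)
  g₀≢ i = (λ ()) ∘ g-inj
  g′ : Fin m → Fin n
  g′ i = punchOut (g₀≢ i)
  g′-inj : Injective _≡_ _≡_ g′
  g′-inj = suc-injective ∘ g-inj ∘ punchOut-injective (g₀≢ _) (g₀≢ _)

positive⇒≤total : ∀ {m} (h : Fin m → ℕ) → (∀ i → 0 < h i) → m ≤ total h
positive⇒≤total {zero}  _ _   = z≤n
positive⇒≤total {suc m} h pos =
  subst (suc m ≤_) (sym (total-suc h)) (+-mono-≤ (pos zero) (positive⇒≤total (h ∘ suc) (pos ∘ suc)))

injectionIntoSupport⇒≤total : ∀ {m n} (f : Fin n → ℕ) {g : Fin m → Fin n} →
                              Injective _≡_ _≡_ g → (∀ i → 0 < f (g i)) → m ≤ total f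
injectionIntoSupport⇒≤total f g-inj pos = ≤-trans (positive⇒≤total _ pos) (total-∘-injective f g-inj)

indicator : ∀ {n} → Subset n → Fin n → ℕ
indicator A v = if lookup A v then 1 else 0

total-indicator : ∀ {n} (A : Subset n) → total (indicator A) ≡ ∣ A ∣
total-indicator []            = refl
total-indicator (inside ∷ A)  = trans (total-suc (indicator (inside ∷ A))) (cong suc (total-indicator A))
total-indicator (outside ∷ A) = trans (total-suc (indicator (outside ∷ A))) (total-indicator A)

adjacencyResolving⇒resolvingBroadcast : ∀ {n} {E : Rel n} {A} →
  IsAdjacencyResolving E A → IsResolvingBroadcast E (indicator A)
adjacencyResolving⇒resolvingBroadcast {E = E} {A} resolving x y x≢y with resolving x y x≢y
... | z , z∈A , sep = z , subst (λ r → 0 < r × Separates E r z x y) (sym indicator≡1) (s≤s z≤n , sep)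
  where
  indicator≡1 : indicator A z ≡ 1
  indicator≡1 = cong (if_then 1 else 0) ([]=⇒lookup z∈A)

adimIs∧bdimIs : ∀ {n} {E : Rel n} {A d} → IsAdjacencyResolving E A → ∣ A ∣ ≡ d →
             (∀ f → IsResolvingBroadcast E f → d ≤ total f) → AdimIs E d × BdimIs E d
adimIs∧bdimIs {A = A} resolving refl lower =
  ((A , resolving , refl) ,
   λ B B-resolving → subst (_ ≤_) (total-indicator B) (lower _ (adjacencyResolving⇒resolvingBroadcast B-resolving))) ,
  ((indicator A , adjacencyResolving⇒resolvingBroadcast resolving , total-indicator A) , lower)

-- Complete graphs

positive≢silent : ∀ {n} {f : Fin n → ℕ} {z v} → 0 < f z → f v ≡ 0 → z ≢ v
positive≢silent fz>0 fv≡0 refl with subst (0 <_) fv≡0 fz>0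
... | ()

complete : ∀ {n} → Rel n
complete u v = not (does (u ≟ᶠ v))

complete-adjacent : ∀ {n} {u v : Fin n} → u ≢ v → complete u v ≡ true
complete-adjacent {u = u} {v} u≢v with u ≟ᶠ v
... | yes u≡v = ⊥-elim (u≢v u≡v)
... | no _    = refl

complete-isSimpleGraph : ∀ {n} → IsSimpleGraph (complete {n})
complete-isSimpleGraph = symmetric , irreflexive
  where
  symmetric : ∀ u v → complete u v ≡ complete v u
  symmetric u v with u ≟ᶠ v | v ≟ᶠ u
  ... | yes _   | yes _   = refl
  ... | no _    | no _    = refl
  ... | yes u≡v | no v≢u  = ⊥-elim (v≢u (sym u≡v))
  ... | no u≢v  | yes v≡u = ⊥-elim (u≢v (sym v≡u))
  irreflexive : ∀ u → complete u u ≡ false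
  irreflexive u with u ≟ᶠ u
  ... | yes _  = refl
  ... | no u≢u = ⊥-elim (u≢u refl)

complete-silent-unique : ∀ {n} {f : Fin n → ℕ} → IsResolvingBroadcast complete f →
                        ∀ {v w} → v ≢ w → f v ≡ 0 → f w ≢ 0
complete-silent-unique resolving v≢w fv≡0 fw≡0 with resolving _ _ v≢w
... | z , fz>0 , sep =
  adjacentToBoth⇒¬separates z≢v z≢w (complete-adjacent z≢v) (complete-adjacent z≢w) sep
  where
  z≢v = positive≢silent fz>0 fv≡0
  z≢w = positive≢silent fz>0 fw≡0

complete-≤total : ∀ {n} (f : Fin (suc n) → ℕ) → IsResolvingBroadcast complete f → n ≤ total f
complete-≤total {n} f resolving with any? (λ v → f v ≟ⁿ 0)
... | yes (v , fv≡0) = injectionIntoSupport⇒≤total f (punchIn-injective v _ _)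
                         (λ j → n≢0⇒n>0 (complete-silent-unique resolving (punchInᵢ≢i v j ∘ sym) fv≡0))
... | no ∄silent     = ≤-trans (n≤1+n n)
                         (injectionIntoSupport⇒≤total f id (λ v → n≢0⇒n>0 (∄silent ∘ (v ,_))))

complete-resolvingSet : ∀ {n} → IsAdjacencyResolving complete (outside ∷ ⊤ {n})
complete-resolvingSet zero    zero    0≢0  = ⊥-elim (0≢0 refl)
complete-resolvingSet zero    (suc j) 0≢sj = suc j , there ∈⊤ , separates-sym (separates₁-self (0≢sj ∘ sym))
complete-resolvingSet (suc i) y       si≢y = suc i , there ∈⊤ , separates₁-self si≢y

complete-adimIs∧bdimIs : ∀ n → AdimIs (complete {suc n}) n × BdimIs (complete {suc n}) n
complete-adimIs∧bdimIs n = adimIs∧bdimIs complete-resolvingSet (∣⊤∣≡n n) (complete-≤total {n})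

-- Twin pairs and tournaments

inTwins-supported : ∀ {n} {E : Rel n} {f x y} → (∀ u → E u u ≡ false) →
                    x ≢ y → E x y ≡ false → InTwins E x y →
                    IsResolvingBroadcast E f → 0 < f x ⊎ 0 < f y
inTwins-supported {x = x} {y} irr x≢y x↛y twins resolving with resolving x y x≢y
... | z , fz>0 , sep with z ≟ᶠ x | z ≟ᶠ y
...   | yes refl | _        = inj₁ fz>0
...   | no _     | yes refl = inj₂ fz>0
...   | no z≢x   | no z≢y   = ⊥-elim (inTwins⇒¬separates irr x↛y twins z≢x z≢y sep)

twinPairs⇒≤total : ∀ {m n} {E : Rel n} {f} (x y : Fin m → Fin n) →
                   Injective _≡_ _≡_ [ x , y ]′ → (∀ u → E u u ≡ false) →
                   (∀ i → E (x i) (y i) ≡ false) → (∀ i → InTwins E (x i) (y i)) →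
                   IsResolvingBroadcast E f → m ≤ total f
twinPairs⇒≤total {m} {f = f} x y pairs-inj irr x↛y twins resolving =
  injectionIntoSupport⇒≤total f (side-injective ∘ pairs-inj) side-positive
  where
  supported : ∀ i → 0 < f (x i) ⊎ 0 < f (y i)
  supported i = inTwins-supported irr ((λ ()) ∘ pairs-inj {inj₁ i} {inj₂ i}) (x↛y i) (twins i) resolving
  side : Fin m → Fin m ⊎ Fin m
  side i = [ (λ _ → inj₁ i) , (λ _ → inj₂ i) ]′ (supported i)
  side-positive : ∀ i → 0 < f ([ x , y ]′ (side i))
  side-positive i with supported i
  ... | inj₁ fx>0 = fx>0
  ... | inj₂ fy>0 = fy>0
  side-injective : Injective _≡_ _≡_ side
  side-injective {i} {j} with supported i | supported j
  ... | inj₁ _ | inj₁ _ = λ { refl → refl }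
  ... | inj₁ _ | inj₂ _ = λ ()
  ... | inj₂ _ | inj₁ _ = λ ()
  ... | inj₂ _ | inj₂ _ = λ { refl → refl }

record IsTournament {A : Set} (T : A → A → Bool) : Set where
  field
    irreflexive   : ∀ a → T a a ≡ false
    antisymmetric : ∀ {a b} → a ≢ b → T b a ≡ not (T a b)

tournament⇒orientation : ∀ {n} {T : Rel n} → IsTournament T → IsOrientation complete T
tournament⇒orientation {T = T} tournament = arc⇒edge , edge⇒oneArc
  where
  open IsTournament tournament
  arc⇒edge : ∀ u v → T u v ≡ true → complete u v ≡ true
  arc⇒edge u v uv = complete-adjacent (arc≢noArc {E = T} uv (irreflexive v))
  edge⇒oneArc : ∀ u v → complete u v ≡ true →
                (T u v ≡ true × T v u ≡ false) ⊎ (T u v ≡ false × T v u ≡ true)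
  edge⇒oneArc u v edge with u ≟ᶠ v | T u v in uv
  edge⇒oneArc u v () | yes refl | _
  ... | no u≢v | true  = inj₁ (refl , trans (antisymmetric u≢v) (cong not uv))
  ... | no u≢v | false = inj₂ (refl , trans (antisymmetric u≢v) (cong not uv))

tournament-∘ : ∀ {A B : Set} {T : A → A → Bool} {g : B → A} → Injective _≡_ _≡_ g →
               IsTournament T → IsTournament (λ u v → T (g u) (g v))
tournament-∘ {g = g} g-inj tournament = record
  { irreflexive   = irreflexive ∘ g
  ; antisymmetric = λ u≢v → antisymmetric (u≢v ∘ g-inj)
  }
  where open IsTournament tournament

-- The oriented graph

below : ∀ {k} → Fin k → Vec Bool k
below {suc k} zero    = replicate (suc k) false
below         (suc i) = true ∷ below i

below-irreflexive : ∀ {k} (i : Fin k) → lookup (below i) i ≡ false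
below-irreflexive zero    = refl
below-irreflexive (suc i) = below-irreflexive i

below-antisymmetric : ∀ {k} {i j : Fin k} → i ≢ j → lookup (below j) i ≡ not (lookup (below i) j)
below-antisymmetric {i = zero}  {zero}  0≢0   = ⊥-elim (0≢0 refl)
below-antisymmetric {i = zero}  {suc j} _     = cong not (sym (lookup-replicate j false))
below-antisymmetric {i = suc i} {zero}  _     = lookup-replicate i false
below-antisymmetric {i = suc i} {suc j} si≢sj = below-antisymmetric (si≢sj ∘ cong suc)

below-injective : ∀ {k} → Injective _≡_ _≡_ (below {k})
below-injective {x = zero}  {zero}  _  = refl
below-injective {x = suc i} {suc j} eq = cong suc (below-injective (∷-injectiveʳ eq))
below-injective {x = zero}  {suc j} ()
below-injective {x = suc i} {zero}  ()

belowIndex : ∀ {k} → Vec Bool k → Maybe (Fin k)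
belowIndex p with any? (λ i → ≡-dec _≟ᵇ_ p (below i))
... | yes (i , _) = just i
... | no _        = nothing

belowIndex-sound : ∀ {k} {p : Vec Bool k} {i} → belowIndex p ≡ just i → p ≡ below i
belowIndex-sound {p = p} eq with any? (λ i → ≡-dec _≟ᵇ_ p (below i))
belowIndex-sound refl | yes (_ , p≡below) = p≡below

belowIndex-below : ∀ {k} (i : Fin k) → belowIndex (below i) ≡ just i
belowIndex-below i with any? (λ j → ≡-dec _≟ᵇ_ (below i) (below j))
... | yes (j , eq) = cong just (sym (below-injective eq))
... | no ∄        = ⊥-elim (∄ (i , refl))

lexLess : ∀ {k} → Vec Bool k → Vec Bool k → Bool
lexLess []          []          = false
lexLess (false ∷ p) (true ∷ q)  = true
lexLess (true ∷ p)  (false ∷ q) = false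
lexLess (false ∷ p) (false ∷ q) = lexLess p q
lexLess (true ∷ p)  (true ∷ q)  = lexLess p q

lexLess-tournament : ∀ {k} → IsTournament (lexLess {k})
lexLess-tournament = record { irreflexive = irreflexive ; antisymmetric = antisymmetric }
  where
  irreflexive : ∀ {k} (p : Vec Bool k) → lexLess p p ≡ false
  irreflexive []          = refl
  irreflexive (false ∷ p) = irreflexive p
  irreflexive (true ∷ p)  = irreflexive p
  antisymmetric : ∀ {k} {p q : Vec Bool k} → p ≢ q → lexLess q p ≡ not (lexLess p q)
  antisymmetric {p = []}        {[]}        []≢[] = ⊥-elim ([]≢[] refl)
  antisymmetric {p = false ∷ p} {true ∷ q}  _     = refl
  antisymmetric {p = true ∷ p}  {false ∷ q} _     = refl
  antisymmetric {p = false ∷ p} {false ∷ q} p≢q   = antisymmetric (p≢q ∘ cong (false ∷_))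
  antisymmetric {p = true ∷ p}  {true ∷ q}  p≢q   = antisymmetric (p≢q ∘ cong (true ∷_))

-- The arcs into below j copy those into inj₁ j in tournament below, which makes the two
-- in-twins; the remaining vectors are ordered lexicographically.
vectorArcVia : ∀ {k} → Maybe (Fin k) → Maybe (Fin k) → Vec Bool k → Vec Bool k → Bool
vectorArcVia (just i) (just j) _ _ = lookup (below j) i
vectorArcVia nothing  (just j) p _ = not (lookup p j)
vectorArcVia (just i) nothing  _ q = lookup q i
vectorArcVia nothing  nothing  p q = lexLess p q

vectorArc : ∀ {k} → Vec Bool k → Vec Bool k → Bool
vectorArc p q = vectorArcVia (belowIndex p) (belowIndex q) p q

vectorArc-tournament : ∀ {k} → IsTournament (vectorArc {k})
vectorArc-tournament = record { irreflexive = irreflexive ; antisymmetric = antisymmetric }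
  where
  irreflexive : ∀ {k} (p : Vec Bool k) → vectorArc p p ≡ false
  irreflexive p with belowIndex p
  ... | just i  = below-irreflexive i
  ... | nothing = IsTournament.irreflexive lexLess-tournament p
  antisymmetric : ∀ {k} {p q : Vec Bool k} → p ≢ q → vectorArc q p ≡ not (vectorArc p q)
  antisymmetric {p = p} {q} p≢q with belowIndex p in ep | belowIndex q in eq
  ... | just i  | just j  = below-antisymmetric (i≢j ∘ sym)
    where
    i≢j : i ≢ j
    i≢j refl = p≢q (trans (belowIndex-sound ep) (sym (belowIndex-sound eq)))
  ... | just i  | nothing = refl
  ... | nothing | just j  = sym (not-involutive _)
  ... | nothing | nothing = IsTournament.antisymmetric lexLess-tournament p≢q

vectorArc-intoBelow : ∀ {k} {p : Vec Bool k} {i} → p ≢ below i → vectorArc p (below i) ≡ not (lookup p i)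
vectorArc-intoBelow {p = p} {i} p≢below rewrite belowIndex-below i with belowIndex p in ep
... | just j  = subst (λ v → lookup (below i) j ≡ not (lookup v i)) (sym (belowIndex-sound ep))
                  (below-antisymmetric j≢i)
  where
  j≢i : j ≢ i
  j≢i refl = p≢below (belowIndex-sound ep)
... | nothing = refl

Vertex : ℕ → Set
Vertex k = Fin k ⊎ Vec Bool k

tournament : ∀ {k} → Vertex k → Vertex k → Bool
tournament (inj₁ i) (inj₁ j) = lookup (below j) i
tournament (inj₁ i) (inj₂ q) = lookup q i
tournament (inj₂ p) (inj₁ j) = not (lookup p j)
tournament (inj₂ p) (inj₂ q) = vectorArc p q

tournament-isTournament : ∀ {k} → IsTournament (tournament {k})
tournament-isTournament = record { irreflexive = irreflexive ; antisymmetric = antisymmetric }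
  where
  irreflexive : ∀ {k} (a : Vertex k) → tournament a a ≡ false
  irreflexive (inj₁ i) = below-irreflexive i
  irreflexive (inj₂ p) = IsTournament.irreflexive vectorArc-tournament p
  antisymmetric : ∀ {k} {a b : Vertex k} → a ≢ b → tournament b a ≡ not (tournament a b)
  antisymmetric {a = inj₁ i} {inj₁ j} i≢j = below-antisymmetric (i≢j ∘ cong inj₁ ∘ sym)
  antisymmetric {a = inj₁ i} {inj₂ q} _   = refl
  antisymmetric {a = inj₂ p} {inj₁ j} _   = sym (not-involutive _)
  antisymmetric {a = inj₂ p} {inj₂ q} p≢q = IsTournament.antisymmetric vectorArc-tournament (p≢q ∘ cong inj₂)

tournament-inTwins : ∀ {k} (i : Fin k) → InTwins tournament (inj₁ i) (inj₂ (below i))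
tournament-inTwins i (inj₁ j) _ _         = refl
tournament-inTwins i (inj₂ p) _ p≢below = sym (vectorArc-intoBelow (p≢below ∘ cong inj₂))

bits↔Fin : ∀ k → Vec Bool k ↔ Fin (2 ^ k)
bits↔Fin zero    = mk↔ₛ′ (λ _ → zero) (λ _ → []) (λ { zero → refl }) (λ { [] → refl })
bits↔Fin (suc k) = ↔-trans uncons (↔-trans (↔-sym 2↔Bool ×-↔ bits↔Fin k) (↔-sym *↔×))
  where
  uncons : Vec Bool (suc k) ↔ (Bool × Vec Bool k)
  uncons = mk↔ₛ′ (λ { (b ∷ p) → b , p }) (λ (b , p) → b ∷ p) (λ _ → refl) (λ { (_ ∷ _) → refl })

vertices : ∀ k → Vertex k ↔ Fin (k + 2 ^ k)
vertices k = ↔-trans (↔-refl ⊎-↔ bits↔Fin k) (↔-sym +↔⊎)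

initialSegment : ∀ a b → Subset (a + b)
initialSegment zero    b = ⊥
initialSegment (suc a) b = inside ∷ initialSegment a b

∣initialSegment∣ : ∀ a b → ∣ initialSegment a b ∣ ≡ a
∣initialSegment∣ zero    b = ∣⊥∣≡0 b
∣initialSegment∣ (suc a) b = cong suc (∣initialSegment∣ a b)

↑ˡ∈initialSegment : ∀ {a} b (i : Fin a) → i ↑ˡ b ∈ initialSegment a b
↑ˡ∈initialSegment b zero    = here
↑ˡ∈initialSegment b (suc i) = there (↑ˡ∈initialSegment b i)

module OrientedGraph (k : ℕ) where

  open Inverse (vertices k) using (to; from; strictlyInverseˡ; strictlyInverseʳ)

  n : ℕ
  n = k + 2 ^ k

  arc : Rel n
  arc u v = tournament (from u) (from v)

  leaf : Fin k → Fin n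
  leaf i = to (inj₁ i)

  twin : Fin k → Fin n
  twin i = to (inj₂ (below i))

  leaves : Subset n
  leaves = initialSegment k (2 ^ k)

  from-injective : Injective _≡_ _≡_ from
  from-injective {u} {v} eq = trans (sym (strictlyInverseˡ u)) (trans (cong to eq) (strictlyInverseˡ v))

  to-injective : Injective _≡_ _≡_ to
  to-injective {a} {b} eq = trans (sym (strictlyInverseʳ a)) (trans (cong from eq) (strictlyInverseʳ b))

  arc-isTournament : IsTournament arc
  arc-isTournament = tournament-∘ from-injective tournament-isTournament

  arc-to : ∀ a b → arc (to a) (to b) ≡ tournament a b
  arc-to a b rewrite strictlyInverseʳ a | strictlyInverseʳ b = refl

  arc-inTwins : ∀ {a b} → InTwins tournament a b → InTwins arc (to a) (to b)
  arc-inTwins {a} {b} twins w w≢a w≢b rewrite strictlyInverseʳ a | strictlyInverseʳ b =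
    twins (from w) (w≢a ∘ from≡) (w≢b ∘ from≡)
    where
    from≡ : ∀ {c} → from w ≡ c → w ≡ to c
    from≡ refl = sym (strictlyInverseˡ w)

  from≡inj₁⇒∈leaves : ∀ {x i} → from x ≡ inj₁ i → x ∈ leaves
  from≡inj₁⇒∈leaves {x} {i} eq =
    subst (_∈ leaves) (trans (cong to (sym eq)) (strictlyInverseˡ x)) (↑ˡ∈initialSegment (2 ^ k) i)

  twinPairs-injective : Injective _≡_ _≡_ [ leaf , twin ]′
  twinPairs-injective {inj₁ i} {inj₁ j} eq with to-injective {inj₁ i} {inj₁ j} eq
  ... | refl = refl
  twinPairs-injective {inj₁ i} {inj₂ j} eq with to-injective {inj₁ i} {inj₂ (below j)} eq
  ... | ()
  twinPairs-injective {inj₂ i} {inj₁ j} eq with to-injective {inj₂ (below i)} {inj₁ j} eq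
  ... | ()
  twinPairs-injective {inj₂ i} {inj₂ j} eq =
    cong inj₂ (below-injective (inj₂-injective (to-injective {inj₂ (below i)} {inj₂ (below j)} eq)))

  arc-≤total : ∀ f → IsResolvingBroadcast arc f → k ≤ total f
  arc-≤total f = twinPairs⇒≤total leaf twin twinPairs-injective (IsTournament.irreflexive arc-isTournament)
    (λ i → trans (arc-to (inj₁ i) (inj₂ (below i))) (below-irreflexive i))
    (λ i → arc-inTwins (tournament-inTwins i))

  leaves-resolving : IsAdjacencyResolving arc leaves
  leaves-resolving x y x≢y with from x in fx | from y in fy
  ... | inj₁ _ | _      = x , from≡inj₁⇒∈leaves fx , separates₁-self x≢y
  ... | inj₂ _ | inj₁ _ = y , from≡inj₁⇒∈leaves fy , separates-sym (separates₁-self (x≢y ∘ sym))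
  ... | inj₂ p | inj₂ q with ¬∀⟶∃¬ k _ (λ j → lookup p j ≟ᵇ lookup q j) (p≢q ∘ lookup-extensional)
    where
    p≢q : p ≢ q
    p≢q refl = x≢y (from-injective (trans fx (sym fy)))
    lookup-extensional : (∀ j → lookup p j ≡ lookup q j) → p ≡ q
    lookup-extensional eq = trans (sym (tabulate∘lookup p)) (trans (tabulate-cong eq) (tabulate∘lookup q))
  ...   | j , pj≢qj = leaf j , ↑ˡ∈initialSegment (2 ^ k) j ,
                      separates₁-byArc (leaf≢ fx) (leaf≢ fy) (pj≢qj ∘ arcs-equal)
    where
    leaf≢ : ∀ {v r} → from v ≡ inj₂ r → leaf j ≢ v
    leaf≢ {v} fv refl with trans (sym (strictlyInverseʳ (inj₁ j))) fv
    ... | ()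
    arc-leaf : ∀ {v r} → from v ≡ inj₂ r → arc (leaf j) v ≡ lookup r j
    arc-leaf fv rewrite strictlyInverseʳ (inj₁ j) | fv = refl
    arcs-equal : arc (leaf j) x ≡ arc (leaf j) y → lookup p j ≡ lookup q j
    arcs-equal eq = trans (sym (arc-leaf fx)) (trans eq (arc-leaf fy))

  arc-adimIs∧bdimIs : AdimIs arc k × BdimIs arc k
  arc-adimIs∧bdimIs = adimIs∧bdimIs leaves-resolving (∣initialSegment∣ k (2 ^ k)) arc-≤total

theorem5p4 : ∀ (k : ℕ) → 1 ≤ k →
    Σ ℕ λ n → Σ (Rel n) λ adj → Σ (Rel n) λ arc →
      IsSimpleGraph adj × IsOrientation adj arc ×
      (Σ ℕ λ aG → Σ ℕ λ bG → Σ ℕ λ aD → Σ ℕ λ bD →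
        AdimIs adj aG × BdimIs adj bG × AdimIs arc aD × BdimIs arc bD ×
        aG ≥ bG × bG ≡ 2 ^ k + k ∸ 1 × k ≥ aD × aD ≥ bD)
theorem5p4 zero    ()
theorem5p4 (suc k′) _ =
  n , complete , arc , complete-isSimpleGraph , tournament⇒orientation arc-isTournament ,
  (k′ + 2 ^ k , k′ + 2 ^ k , k , k ,
   proj₁ (complete-adimIs∧bdimIs _) , proj₂ (complete-adimIs∧bdimIs _) ,
   proj₁ arc-adimIs∧bdimIs , proj₂ arc-adimIs∧bdimIs ,
   ≤-refl , k′+2^k≡2^k+k∸1 , ≤-refl , ≤-refl)
  where
  k = suc k′
  open OrientedGraph k
  k′+2^k≡2^k+k∸1 : k′ + 2 ^ k ≡ 2 ^ k + k ∸ 1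
  k′+2^k≡2^k+k∸1 = trans (+-comm k′ (2 ^ k)) (cong (_∸ 1) (sym (+-suc (2 ^ k) k′)))
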